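{- Let $G=(V,E)$ be a unit disk graph and let $D$ be the set returned by the following algorithm on input $G$. Start with $D=\emptyset$ and $W=V$. For $i=1,2,3$: if $W\neq\emptyset$, let $I_i$ be a maximal independent set of the subgraph of $G$ induced by $W$, set $D\leftarrow D\cup I_i$ and $W\leftarrow W\setminus I_i$ (if $W=\emptyset$, $I_i=\emptyset$). Then, for every $u\in I_1$: if $N_G(u)\cap(I_2\cup I_3)=\emptyset$, choose a vertex $v\in N_G(u)$ and add $v$ to $D$; else if $N_G(u)\cap(I_2\cup I_3)=\{v\}$ consists of exactly one vertex $v$, choose a neighbor $w$ of $v$ in $G$ with $w\neq u$ and add $w$ to $D$. Return $D$. Then $D$ is a liar's dominating set of $G$.
   Context: A unit disk graph (UDG) $G=(V,E)$ is the graph whose vertices correspond to points in the plane, two distinct vertices being adjacent if and only if the Euclidean distance between the corresponding points is at most $1$. $N_G(v)$ is the open neighborhood of $v$ in $G$ and $N_G[v]=N_G(v)\cup\{v\}$. A liar's dominating set (LDS) of $G$ is a set $D\subseteq V$ such that (i) $|N_G[v]\cap D|\ge 2$ for every $v\in V$, and (ii) $|(N_G[u]\cup N_G[v])\cap D|\ge 3$ for every pair of distinct $u,v\in V$. -}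

module Defs where

open import Data.Nat using (ℕ; _≤_)
open import Data.Bool using (Bool; true; false)
open import Data.Fin using (Fin)
open import Data.Fin.Subset using (Subset; ⁅_⁆; _∈_; _∉_; _⊆_; _∩_; _∪_; _─_; ∣_∣; ⊥; Empty; Nonempty)
open import Data.Vec using (tabulate)
open import Data.Product using (_×_; Σ; ∃; ∃-syntax; _,_)
open import Data.Sum using (_⊎_)
open import Relation.Binary.PropositionalEquality using (_≡_; _≢_)

record Graph (n : ℕ) : Set where
  field
    adj    : Fin n → Fin n → Bool
    sym    : ∀ u v → adj u v ≡ adj v u
    irrefl : ∀ v → adj v v ≡ false
open Graph public

module _ {n : ℕ} (G : Graph n) where

  N : Fin n → Subset n
  N v = tabulate (adj G v)

  N[_] : Fin n → Subset n
  N[ v ] = N v ∪ ⁅ v ⁆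

  Independent : Subset n → Set
  Independent I = ∀ u v → u ∈ I → v ∈ I → adj G u v ≡ false

  MaximalIndependentIn : Subset n → Subset n → Set
  MaximalIndependentIn W I =
    I ⊆ W × Independent I ×
    (∀ J → J ⊆ W → Independent J → I ⊆ J → J ⊆ I)

  Step : Subset n → Subset n → Set
  Step W I = (Empty W × I ≡ ⊥) ⊎ (Nonempty W × MaximalIndependentIn W I)

  IsLDS : Subset n → Set
  IsLDS D =
    (∀ v → 2 ≤ ∣ N[ v ] ∩ D ∣) ×
    (∀ u v → u ≢ v → 3 ≤ ∣ (N[ u ] ∪ N[ v ]) ∩ D ∣)

  -- D is a possible output of the algorithm on input G, for the choices
  -- I₁, I₂, I₃ (first loop) and the choice function c (second loop:
  -- c u is the vertex chosen for u ∈ I₁, when one is added).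
  AlgorithmOutput : Subset n → Set
  AlgorithmOutput D =
    Σ (Subset n) λ I₁ → Σ (Subset n) λ I₂ → Σ (Subset n) λ I₃ →
    Σ (Fin n → Fin n) λ c →
      Step (tabulate (λ _ → true)) I₁ ×
      Step ((tabulate (λ _ → true)) ─ I₁) I₂ ×
      Step (((tabulate (λ _ → true)) ─ I₁) ─ I₂) I₃ ×
      (∀ u → u ∈ I₁ → N u ∩ (I₂ ∪ I₃) ≡ ⊥ → c u ∈ N u) ×
      (∀ u v → u ∈ I₁ → N u ∩ (I₂ ∪ I₃) ≡ ⁅ v ⁆ → c u ∈ N v × c u ≢ u) ×
      -- D = I₁ ∪ I₂ ∪ I₃ ∪ { added vertices }
      (∀ x → x ∈ D →
        x ∈ I₁ ⊎ x ∈ I₂ ⊎ x ∈ I₃ ⊎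
        (∃[ u ] (u ∈ I₁ × (N u ∩ (I₂ ∪ I₃) ≡ ⊥ ⊎ ∃[ v ] (N u ∩ (I₂ ∪ I₃) ≡ ⁅ v ⁆)) × c u ≡ x))) ×
      (∀ x →
        x ∈ I₁ ⊎ x ∈ I₂ ⊎ x ∈ I₃ ⊎
        (∃[ u ] (u ∈ I₁ × (N u ∩ (I₂ ∪ I₃) ≡ ⊥ ⊎ ∃[ v ] (N u ∩ (I₂ ∪ I₃) ≡ ⁅ v ⁆)) × c u ≡ x)) →
        x ∈ D)

module Submission where

open import Defs
open import Data.Nat using (ℕ; _≤_; s≤s; z≤n)
open import Data.Nat.Properties using (≤-trans; ≤-<-trans)
open import Data.Bool using (Bool; true; false)
open import Data.Bool.Properties using () renaming (_≟_ to _≟ᵇ_)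
open import Data.Fin using (Fin; _≟_)
open import Data.Fin.Properties using (any?)
open import Data.Fin.Subset
  using (Subset; inside; outside; ⁅_⁆; _∈_; _∉_; _⊆_; _∩_; _∪_; _─_; _-_; ∣_∣; ⊥; Nonempty)
open import Data.Fin.Subset.Properties
  using ( x∈p⇒∣p-x∣<∣p∣; x∈p∧x≢y⇒x∈p-y; x∈p∧x∉q⇒x∈p─q; p─q⊆p; p⊆q⇒∣p∣≤∣q∣
        ; x∈⁅x⁆; x∈⁅y⁆⇒x≡y; ⊆-antisym; Empty-unique; nonempty?
        ; x∈p∩q⁺; x∈p∩q⁻; x∈p∪q⁺; x∈p∪q⁻; p⊆p∪q; ∉⊥; ∪-comm; _∈?_)
open import Data.List using (List; _∷_; length)
open import Data.List.Relation.Unary.All using (All; []; _∷_)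
import Data.List.Relation.Unary.All as All
open import Data.List.Relation.Unary.AllPairs using ([]; _∷_)
open import Data.List.Relation.Unary.Unique.Propositional using (Unique)
open import Data.Vec using (_∷_; tabulate; here; there)
open import Data.Vec.Properties using (lookup∘tabulate; lookup⇒[]=; []=⇒lookup)
open import Data.Product using (_×_; ∃-syntax; _,_; proj₁; proj₂)
open import Data.Sum using (_⊎_; inj₁; inj₂)
open import Data.Empty using (⊥-elim)
open import Relation.Nullary using (yes; no)
open import Relation.Nullary.Decidable using (_×-dec_; ¬?)
open import Relation.Binary.PropositionalEquality
  using (_≡_; _≢_; refl; trans; subst; cong; ≢-sym)
  renaming (sym to ≡-sym)

x∈p─q⇒x∉q : ∀ {n} (p q : Subset n) {x} → x ∈ p ─ q → x ∉ q
x∈p─q⇒x∉q (inside ∷ p)  (outside ∷ q) here      ()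
x∈p─q⇒x∉q (s ∷ p)       (t ∷ q)       (there m) (there m′) = x∈p─q⇒x∉q p q m m′

module _ {n : ℕ} where

  distinct-members-≤ : ∀ {p : Subset n} {xs : List (Fin n)} →
                       Unique xs → All (_∈ p) xs → length xs ≤ ∣ p ∣
  distinct-members-≤ []                 []            = z≤n
  distinct-members-≤ {p} {x ∷ xs} (x≢xs ∷ unique-xs) (x∈p ∷ xs⊆p) =
    ≤-<-trans (distinct-members-≤ unique-xs xs⊆p-x) (x∈p⇒∣p-x∣<∣p∣ x∈p)
    where
    xs⊆p-x : All (_∈ p - x) xs
    xs⊆p-x = All.zipWith (λ (y∈p , x≢y) → x∈p∧x≢y⇒x∈p-y y∈p (≢-sym x≢y))
                         (xs⊆p , x≢xs)

  at-least-two : ∀ {p : Subset n} {a b} → a ∈ p → b ∈ p → a ≢ b → 2 ≤ ∣ p ∣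
  at-least-two a∈p b∈p a≢b =
    distinct-members-≤ ((a≢b ∷ []) ∷ [] ∷ []) (a∈p ∷ b∈p ∷ [])

  at-least-three : ∀ {p : Subset n} {a b c} → a ∈ p → b ∈ p → c ∈ p →
                   a ≢ b → a ≢ c → b ≢ c → 3 ≤ ∣ p ∣
  at-least-three a∈p b∈p c∈p a≢b a≢c b≢c =
    distinct-members-≤ ((a≢b ∷ a≢c ∷ []) ∷ (b≢c ∷ []) ∷ [] ∷ []) (a∈p ∷ b∈p ∷ c∈p ∷ [])

  ∈∉⇒≢ : ∀ {p : Subset n} {a b} → a ∈ p → b ∉ p → a ≢ b
  ∈∉⇒≢ a∈p b∉p refl = b∉p a∈p

  ∈-tabulate⁺ : ∀ (f : Fin n → Bool) {x} → f x ≡ true → x ∈ tabulate f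
  ∈-tabulate⁺ f {x} fx = lookup⇒[]= x (tabulate f) (trans (lookup∘tabulate f x) fx)

  ∈-tabulate⁻ : ∀ (f : Fin n → Bool) {x} → x ∈ tabulate f → f x ≡ true
  ∈-tabulate⁻ f {x} m = trans (≡-sym (lookup∘tabulate f x)) ([]=⇒lookup m)

  other-member-or-singleton : ∀ {p : Subset n} {z} → z ∈ p →
                              (∃[ y ] y ∈ p × y ≢ z) ⊎ p ≡ ⁅ z ⁆
  other-member-or-singleton {p} {z} z∈p
    with any? (λ y → (y ∈? p) ×-dec ¬? (y ≟ z))
  ... | yes other = inj₁ other
  ... | no ¬other = inj₂ (⊆-antisym only-z (λ y∈⁅z⁆ → subst (_∈ p) (≡-sym (x∈⁅y⁆⇒x≡y z y∈⁅z⁆)) z∈p))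
    where
    only-z : p ⊆ ⁅ z ⁆
    only-z {y} y∈p with y ≟ z
    ... | yes refl = x∈⁅x⁆ y
    ... | no y≢z   = ⊥-elim (¬other (y , y∈p , y≢z))

  -- Decidable emptiness, in the form the second loop of the algorithm tests.
  member-or-empty : ∀ (p : Subset n) → Nonempty p ⊎ p ≡ ⊥
  member-or-empty p with nonempty? p
  ... | yes ne = inj₁ ne
  ... | no ¬ne = inj₂ (Empty-unique ¬ne)

module Adjacency {n : ℕ} (G : Graph n) where

  Adj : Fin n → Fin n → Set
  Adj x y = adj G x y ≡ true

  adj-sym : ∀ {x y} → Adj x y → Adj y x
  adj-sym {x} {y} xy = trans (Graph.sym G y x) xy

  adj⇒≢ : ∀ {x y} → Adj x y → x ≢ y
  adj⇒≢ {x} xx refl with trans (≡-sym xx) (irrefl G x)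
  ... | ()

  ∈N⁺ : ∀ {u x} → Adj u x → x ∈ N G u
  ∈N⁺ {u} = ∈-tabulate⁺ (adj G u)

  ∈N⁻ : ∀ {u x} → x ∈ N G u → Adj u x
  ∈N⁻ {u} = ∈-tabulate⁻ (adj G u)

  ∈N[]-self : ∀ u → u ∈ N[_] G u
  ∈N[]-self u = x∈p∪q⁺ (inj₂ (x∈⁅x⁆ u))

  ∈N[]-adj : ∀ {u x} → Adj u x → x ∈ N[_] G u
  ∈N[]-adj ux = x∈p∪q⁺ (inj₁ (∈N⁺ ux))

  -- A maximal independent set I of G[W] dominates W: otherwise I ∪ {x}
  -- would be a strictly larger independent subset of W.
  maximal⇒dominating : ∀ {W I x} → MaximalIndependentIn G W I → x ∈ W → x ∉ I →
                       ∃[ y ] y ∈ I × Adj x y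
  maximal⇒dominating {W} {I} {x} (I⊆W , indep , maximal) x∈W x∉I
    with any? (λ y → (y ∈? I) ×-dec (adj G x y ≟ᵇ true))
  ... | yes dominated = dominated
  ... | no ¬dominated = ⊥-elim (x∉I (maximal J J⊆W indep-J (p⊆p∪q ⁅ x ⁆) (x∈p∪q⁺ (inj₂ (x∈⁅x⁆ x)))))
    where
    J = I ∪ ⁅ x ⁆

    non-adj : ∀ {y} → y ∈ I → adj G x y ≡ false
    non-adj {y} y∈I with adj G x y in xy
    ... | true  = ⊥-elim (¬dominated (y , y∈I , xy))
    ... | false = refl

    J⊆W : J ⊆ W
    J⊆W y∈J with x∈p∪q⁻ I ⁅ x ⁆ y∈J
    ... | inj₁ y∈I = I⊆W y∈I
    ... | inj₂ y∈⁅x⁆ rewrite x∈⁅y⁆⇒x≡y x y∈⁅x⁆ = x∈W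

    indep-J : Independent G J
    indep-J a b a∈J b∈J with x∈p∪q⁻ I ⁅ x ⁆ a∈J | x∈p∪q⁻ I ⁅ x ⁆ b∈J
    ... | inj₁ a∈I | inj₁ b∈I = indep a b a∈I b∈I
    ... | inj₂ a∈⁅x⁆ | inj₁ b∈I rewrite x∈⁅y⁆⇒x≡y x a∈⁅x⁆ = non-adj b∈I
    ... | inj₁ a∈I | inj₂ b∈⁅x⁆ rewrite x∈⁅y⁆⇒x≡y x b∈⁅x⁆ = trans (Graph.sym G a x) (non-adj a∈I)
    ... | inj₂ a∈⁅x⁆ | inj₂ b∈⁅x⁆ rewrite x∈⁅y⁆⇒x≡y x a∈⁅x⁆ | x∈⁅y⁆⇒x≡y x b∈⁅x⁆ = irrefl G x

  step⊆ : ∀ {W I} → Step G W I → I ⊆ W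
  step⊆ (inj₁ (_ , refl)) x∈⊥ = ⊥-elim (∉⊥ x∈⊥)
  step⊆ (inj₂ (_ , I⊆W , _)) = I⊆W

  step-independent : ∀ {W I} → Step G W I → Independent G I
  step-independent (inj₁ (_ , refl)) _ _ a∈⊥ _ = ⊥-elim (∉⊥ a∈⊥)
  step-independent (inj₂ (_ , _ , indep , _)) = indep

  step-dominating : ∀ {W I x} → Step G W I → x ∈ W → x ∉ I → ∃[ y ] y ∈ I × Adj x y
  step-dominating (inj₁ (W-empty , _)) x∈W _ = ⊥-elim (W-empty (_ , x∈W))
  step-dominating (inj₂ (_ , mis)) = maximal⇒dominating mis

module Run {n : ℕ} (G : Graph n) (D I₁ I₂ I₃ : Subset n) (c : Fin n → Fin n)
  (step₁ : Step G (tabulate (λ _ → true)) I₁)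
  (step₂ : Step G (tabulate (λ _ → true) ─ I₁) I₂)
  (step₃ : Step G (tabulate (λ _ → true) ─ I₁ ─ I₂) I₃)
  (choice-lonely : ∀ u → u ∈ I₁ → N G u ∩ (I₂ ∪ I₃) ≡ ⊥ → c u ∈ N G u)
  (choice-single : ∀ u v → u ∈ I₁ → N G u ∩ (I₂ ∪ I₃) ≡ ⁅ v ⁆ → c u ∈ N G v × c u ≢ u)
  (selected⊆D : ∀ x →
     x ∈ I₁ ⊎ x ∈ I₂ ⊎ x ∈ I₃ ⊎
     (∃[ u ] (u ∈ I₁ × (N G u ∩ (I₂ ∪ I₃) ≡ ⊥ ⊎ ∃[ v ] (N G u ∩ (I₂ ∪ I₃) ≡ ⁅ v ⁆)) × c u ≡ x)) →
     x ∈ D)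
  where

  open Adjacency G

  V W₂ : Subset n
  V  = tabulate (λ _ → true)
  W₂ = V ─ I₁

  ∈V : ∀ {x} → x ∈ V
  ∈V = ∈-tabulate⁺ (λ _ → true) refl

  upper : Fin n → Subset n
  upper u = N G u ∩ (I₂ ∪ I₃)

  Dom : Fin n → Subset n
  Dom v = N[_] G v ∩ D

  Dom₂ : Fin n → Fin n → Subset n
  Dom₂ u v = (N[_] G u ∪ N[_] G v) ∩ D

  I₁⊆D : I₁ ⊆ D
  I₁⊆D {x} x∈I₁ = selected⊆D x (inj₁ x∈I₁)

  I₂⊆D : I₂ ⊆ D
  I₂⊆D {x} x∈I₂ = selected⊆D x (inj₂ (inj₁ x∈I₂))

  I₃⊆D : I₃ ⊆ D
  I₃⊆D {x} x∈I₃ = selected⊆D x (inj₂ (inj₂ (inj₁ x∈I₃)))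

  upper⊆D : ∀ {u} → upper u ⊆ D
  upper⊆D {u} y∈upper with x∈p∪q⁻ I₂ I₃ (proj₂ (x∈p∩q⁻ (N G u) (I₂ ∪ I₃) y∈upper))
  ... | inj₁ y∈I₂ = I₂⊆D y∈I₂
  ... | inj₂ y∈I₃ = I₃⊆D y∈I₃

  upper⇒adj : ∀ {u y} → y ∈ upper u → Adj u y
  upper⇒adj {u} y∈upper = ∈N⁻ (proj₁ (x∈p∩q⁻ (N G u) (I₂ ∪ I₃) y∈upper))

  choice∈D : ∀ {u} → u ∈ I₁ → upper u ≡ ⊥ ⊎ ∃[ v ] upper u ≡ ⁅ v ⁆ → c u ∈ D
  choice∈D {u} u∈I₁ few-upper = selected⊆D (c u) (inj₂ (inj₂ (inj₂ (u , u∈I₁ , few-upper , refl))))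

  I₂∌I₁ : ∀ {y} → y ∈ I₂ → y ∉ I₁
  I₂∌I₁ y∈I₂ = x∈p─q⇒x∉q V I₁ (step⊆ step₂ y∈I₂)

  I₃∌I₁ : ∀ {y} → y ∈ I₃ → y ∉ I₁
  I₃∌I₁ y∈I₃ = x∈p─q⇒x∉q V I₁ (p─q⊆p W₂ I₂ (step⊆ step₃ y∈I₃))

  I₃∌I₂ : ∀ {y} → y ∈ I₃ → y ∉ I₂
  I₃∌I₂ y∈I₃ = x∈p─q⇒x∉q W₂ I₂ (step⊆ step₃ y∈I₃)

  I₁-dominates : ∀ {x} → x ∉ I₁ → ∃[ y ] y ∈ I₁ × Adj x y
  I₁-dominates = step-dominating step₁ ∈V

  I₂-dominates : ∀ {x} → x ∉ I₁ → x ∉ I₂ → ∃[ y ] y ∈ I₂ × Adj x y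
  I₂-dominates x∉I₁ = step-dominating step₂ (x∈p∧x∉q⇒x∈p─q ∈V x∉I₁)

  I₃-dominates : ∀ {x} → x ∉ I₁ → x ∉ I₂ → x ∉ I₃ → ∃[ y ] y ∈ I₃ × Adj x y
  I₃-dominates x∉I₁ x∉I₂ =
    step-dominating step₃ (x∈p∧x∉q⇒x∈p─q (x∈p∧x∉q⇒x∈p─q ∈V x∉I₁) x∉I₂)

  data Layer (x : Fin n) : Set where
    first  : x ∈ I₁ → Layer x
    second : x ∈ I₂ → Layer x
    later  : x ∉ I₁ → x ∉ I₂ → Layer x

  layer : ∀ x → Layer x
  layer x with x ∈? I₁ | x ∈? I₂
  ... | yes x∈I₁ | _        = first x∈I₁
  ... | no _     | yes x∈I₂ = second x∈I₂
  ... | no x∉I₁  | no x∉I₂  = later x∉I₁ x∉I₂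

  ∈Dom : ∀ {v y} → y ∈ N[_] G v → y ∈ D → y ∈ Dom v
  ∈Dom y∈N[v] y∈D = x∈p∩q⁺ (y∈N[v] , y∈D)

  ∈Dom₂ : ∀ {u v y} → y ∈ N[_] G u ⊎ y ∈ N[_] G v → y ∈ D → y ∈ Dom₂ u v
  ∈Dom₂ y∈N[u]∪N[v] y∈D = x∈p∩q⁺ (x∈p∪q⁺ y∈N[u]∪N[v] , y∈D)

  left∈Dom₂ : ∀ {u v} → u ∈ D → u ∈ Dom₂ u v
  left∈Dom₂ {u} = ∈Dom₂ (inj₁ (∈N[]-self u))

  right∈Dom₂ : ∀ {u v} → v ∈ D → v ∈ Dom₂ u v
  right∈Dom₂ {v = v} = ∈Dom₂ (inj₂ (∈N[]-self v))

  Dom⊆Dom₂ : ∀ {u v} → Dom u ⊆ Dom₂ u v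
  Dom⊆Dom₂ {u} y∈Dom with x∈p∩q⁻ (N[_] G u) D y∈Dom
  ... | y∈N[u] , y∈D = ∈Dom₂ (inj₁ y∈N[u]) y∈D

  Dom₂-swap : ∀ {k u v} → k ≤ ∣ Dom₂ v u ∣ → k ≤ ∣ Dom₂ u v ∣
  Dom₂-swap {k} {u} {v} = subst (λ p → k ≤ ∣ p ∣) (cong (_∩ D) (∪-comm (N[_] G v) (N[_] G u)))

  I₃-meets-N[] : ∀ {x} → x ∉ I₁ → x ∉ I₂ → ∃[ w ] w ∈ I₃ × w ∈ N[_] G x
  I₃-meets-N[] {x} x∉I₁ x∉I₂ with x ∈? I₃
  ... | yes x∈I₃ = x , x∈I₃ , ∈N[]-self x
  ... | no x∉I₃ with I₃-dominates x∉I₁ x∉I₂ x∉I₃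
  ...   | w , w∈I₃ , xw = w , w∈I₃ , ∈N[]-adj xw

  -- (A) Outside I₁ ∪ I₂, the closed neighbourhood meets all three layers.
  later-sees-three : ∀ {x} → x ∉ I₁ → x ∉ I₂ → 3 ≤ ∣ Dom x ∣
  later-sees-three x∉I₁ x∉I₂
    with I₁-dominates x∉I₁ | I₂-dominates x∉I₁ x∉I₂ | I₃-meets-N[] x∉I₁ x∉I₂
  ... | a , a∈I₁ , xa | b , b∈I₂ , xb | w , w∈I₃ , w∈N[x] =
    at-least-three (∈Dom (∈N[]-adj xa) (I₁⊆D a∈I₁)) (∈Dom (∈N[]-adj xb) (I₂⊆D b∈I₂))
                   (∈Dom w∈N[x] (I₃⊆D w∈I₃))
                   (∈∉⇒≢ a∈I₁ (I₂∌I₁ b∈I₂)) (∈∉⇒≢ a∈I₁ (I₃∌I₁ w∈I₃)) (∈∉⇒≢ b∈I₂ (I₃∌I₂ w∈I₃))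

  -- (B) Every u ∈ I₁ has a neighbour in D: one in I₂ ∪ I₃, or else the
  -- vertex c u added by the second loop.
  first-has-D-neighbour : ∀ {u} → u ∈ I₁ → ∃[ y ] y ∈ D × Adj u y
  first-has-D-neighbour {u} u∈I₁ with member-or-empty (upper u)
  ... | inj₁ (y , y∈upper) = y , upper⊆D y∈upper , upper⇒adj y∈upper
  ... | inj₂ no-upper      = c u , choice∈D u∈I₁ (inj₁ no-upper) , ∈N⁻ (choice-lonely u u∈I₁ no-upper)

  -- (C) If u ∈ I₁ sees z in a later layer, D has a third vertex near u or z:
  -- a second later-layer neighbour of u, or else the neighbour c u of z.
  first-backup : ∀ {u z} → u ∈ I₁ → z ∈ upper u →
                 ∃[ y ] y ∈ D × y ≢ u × y ≢ z × (y ∈ N[_] G u ⊎ y ∈ N[_] G z)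
  first-backup {u} {z} u∈I₁ z∈upper with other-member-or-singleton z∈upper
  ... | inj₁ (y , y∈upper , y≢z) =
    y , upper⊆D y∈upper , ≢-sym (adj⇒≢ (upper⇒adj y∈upper)) , y≢z ,
    inj₁ (∈N[]-adj (upper⇒adj y∈upper))
  ... | inj₂ upper≡z with choice-single u z u∈I₁ upper≡z
  ...   | cu∈N[z] , cu≢u =
    c u , choice∈D u∈I₁ (inj₂ (z , upper≡z)) , cu≢u ,
    ≢-sym (adj⇒≢ (∈N⁻ cu∈N[z])) , inj₂ (∈N[]-adj (∈N⁻ cu∈N[z]))

  closed-neighbourhood-condition : ∀ v → 2 ≤ ∣ Dom v ∣
  closed-neighbourhood-condition v with layer v
  ... | first v∈I₁ with first-has-D-neighbour v∈I₁
  ...   | y , y∈D , vy =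
    at-least-two (∈Dom (∈N[]-self v) (I₁⊆D v∈I₁)) (∈Dom (∈N[]-adj vy) y∈D) (adj⇒≢ vy)
  closed-neighbourhood-condition v | second v∈I₂ with I₁-dominates (I₂∌I₁ v∈I₂)
  ...   | a , a∈I₁ , va =
    at-least-two (∈Dom (∈N[]-self v) (I₂⊆D v∈I₂)) (∈Dom (∈N[]-adj va) (I₁⊆D a∈I₁)) (adj⇒≢ va)
  closed-neighbourhood-condition v | later v∉I₁ v∉I₂ =
    ≤-trans (s≤s (s≤s z≤n)) (later-sees-three v∉I₁ v∉I₂)

  -- The second condition, for each combination of layers.  In every case u
  -- and v themselves lie in D, and a third vertex is found near u or v.
  later-pair : ∀ {u v} → u ∉ I₁ → u ∉ I₂ → 3 ≤ ∣ Dom₂ u v ∣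
  later-pair u∉I₁ u∉I₂ = ≤-trans (later-sees-three u∉I₁ u∉I₂) (p⊆q⇒∣p∣≤∣q∣ Dom⊆Dom₂)

  first-first-pair : ∀ {u v} → u ∈ I₁ → v ∈ I₁ → u ≢ v → 3 ≤ ∣ Dom₂ u v ∣
  first-first-pair {u} {v} u∈I₁ v∈I₁ u≢v with first-has-D-neighbour u∈I₁
  ... | y , y∈D , uy =
    at-least-three (left∈Dom₂ (I₁⊆D u∈I₁)) (right∈Dom₂ (I₁⊆D v∈I₁))
                   (∈Dom₂ (inj₁ (∈N[]-adj uy)) y∈D) u≢v (adj⇒≢ uy) v≢y
    where
    -- y is adjacent to u, while v is not, I₁ being independent.
    v≢y : v ≢ y
    v≢y refl with trans (≡-sym uy) (step-independent step₁ u v u∈I₁ v∈I₁)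
    ... | ()

  first-second-pair : ∀ {u v} → u ∈ I₁ → v ∈ I₂ → u ≢ v → 3 ≤ ∣ Dom₂ u v ∣
  first-second-pair {u} {v} u∈I₁ v∈I₂ u≢v with I₁-dominates (I₂∌I₁ v∈I₂)
  ... | a , a∈I₁ , va with a ≟ u
  ...   | no a≢u =
    at-least-three (left∈Dom₂ (I₁⊆D u∈I₁)) (right∈Dom₂ (I₂⊆D v∈I₂))
                   (∈Dom₂ (inj₂ (∈N[]-adj va)) (I₁⊆D a∈I₁)) u≢v (≢-sym a≢u) (adj⇒≢ va)
  ...   | yes refl with first-backup u∈I₁ (x∈p∩q⁺ (∈N⁺ (adj-sym va) , x∈p∪q⁺ (inj₁ v∈I₂)))
  ...     | y , y∈D , y≢u , y≢v , y-near =
    at-least-three (left∈Dom₂ (I₁⊆D u∈I₁)) (right∈Dom₂ (I₂⊆D v∈I₂)) (∈Dom₂ y-near y∈D)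
                   u≢v (≢-sym y≢u) (≢-sym y≢v)

  second-second-pair : ∀ {u v} → u ∈ I₂ → v ∈ I₂ → u ≢ v → 3 ≤ ∣ Dom₂ u v ∣
  second-second-pair {u} {v} u∈I₂ v∈I₂ u≢v with I₁-dominates (I₂∌I₁ u∈I₂)
  ... | a , a∈I₁ , ua =
    at-least-three (left∈Dom₂ (I₂⊆D u∈I₂)) (right∈Dom₂ (I₂⊆D v∈I₂))
                   (∈Dom₂ (inj₁ (∈N[]-adj ua)) (I₁⊆D a∈I₁))
                   u≢v (adj⇒≢ ua) (≢-sym (∈∉⇒≢ a∈I₁ (I₂∌I₁ v∈I₂)))

  pair-condition : ∀ u v → u ≢ v → 3 ≤ ∣ Dom₂ u v ∣
  pair-condition u v u≢v with layer u | layer v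
  ... | later u∉I₁ u∉I₂ | _ = later-pair u∉I₁ u∉I₂
  ... | _ | later v∉I₁ v∉I₂ = Dom₂-swap (later-pair v∉I₁ v∉I₂)
  ... | first u∈I₁ | first v∈I₁ = first-first-pair u∈I₁ v∈I₁ u≢v
  ... | first u∈I₁ | second v∈I₂ = first-second-pair u∈I₁ v∈I₂ u≢v
  ... | second u∈I₂ | first v∈I₁ = Dom₂-swap (first-second-pair v∈I₁ u∈I₂ (≢-sym u≢v))
  ... | second u∈I₂ | second v∈I₂ = second-second-pair u∈I₂ v∈I₂ u≢v

lemma4 : ∀ (n : ℕ) (G : Graph n) (D : Subset n) → AlgorithmOutput G D → IsLDS G D
lemma4 n G D (I₁ , I₂ , I₃ , c , step₁ , step₂ , step₃ , choice-lonely , choice-single , _ , selected⊆D) =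
  closed-neighbourhood-condition , pair-condition
  where
  open Run G D I₁ I₂ I₃ c step₁ step₂ step₃ choice-lonely choice-single selected⊆D
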